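{- Let $(G,\mathrm{col})$ be an instance of Free-Flood-It and let $S\subseteq V(G)$ be a set of pairwise false-twin vertices (i.e., $N(a)=N(b)$ for all $a,b\in S$) all having the same color. If $|S|\ge \mathrm{OPT}_{\mathrm{Free}}(G,\mathrm{col})+2$, then $\mathrm{OPT}_{\mathrm{Free}}(G,\mathrm{col})=\mathrm{OPT}_{\mathrm{Free}}(G-x,\mathrm{col}|_{G-x})$ for every $x\in S$.
   Context: For a graph $G=(V,E)$ and a coloring $\mathrm{col}\colon V\to[c_{\max}]$, $\mathrm{Comp}(\mathrm{col},u)$ denotes the monochromatic connected component containing $u$. A move is a pair $(u,c)$ with $u\in V$ and $c\in[c_{\max}]$; its result is the coloring obtained by recoloring every vertex of $\mathrm{Comp}(\mathrm{col},u)$ with $c$, other vertices unchanged. $\mathrm{OPT}_{\mathrm{Free}}(G,\mathrm{col})$ is the minimum number of moves in a sequence (applied successively) whose result is a constant coloring. $N(x)$ denotes the open neighborhood of $x$. -}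

module Defs where

open import Data.Nat using (ℕ; zero; suc; _≤_)
open import Data.Fin using (Fin; punchIn)
open import Data.Product using (Σ; _×_; _,_; ∃)
open import Relation.Nullary using (¬_)
open import Relation.Binary.PropositionalEquality using (_≡_)
open import Data.Empty using (⊥)

record Graph (n : ℕ) : Set₁ where
  field
    Adj    : Fin n → Fin n → Set
    sym    : ∀ {u v} → Adj u v → Adj v u
    irrefl : ∀ {u} → Adj u u → ⊥
open Graph public

Coloring : ℕ → ℕ → Set
Coloring n c = Fin n → Fin c

-- MonoPath G col u v : v ∈ Comp(col, u)  (monochromatic walk from u to v)
data MonoPath {n c : ℕ} (G : Graph n) (col : Coloring n c) : Fin n → Fin n → Set where
  here : ∀ {u} → MonoPath G col u u
  step : ∀ {u w v} → Adj G u w → col u ≡ col w → MonoPath G col w v → MonoPath G col u v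

IsMoveResult : {n c : ℕ} → Graph n → Coloring n c → Fin n → Fin c → Coloring n c → Set
IsMoveResult G col u c' col' =
  ∀ v → (MonoPath G col u v → col' v ≡ c') × (¬ MonoPath G col u v → col' v ≡ col v)

Constant : {n c : ℕ} → Coloring n c → Set
Constant col = ∀ v w → col v ≡ col w

FloodsIn : {n c : ℕ} → Graph n → Coloring n c → ℕ → Set
FloodsIn G col zero = Constant col
FloodsIn {n} {c} G col (suc k) =
  Σ (Fin n) λ u → Σ (Fin c) λ c' → Σ (Coloring n c) λ col' →
    IsMoveResult G col u c' col' × FloodsIn G col' k

IsOPTFree : {n c : ℕ} → Graph n → Coloring n c → ℕ → Set
IsOPTFree G col k = FloodsIn G col k × (∀ m → FloodsIn G col m → k ≤ m)

-- G - x, vertices of Fin n re-indexed into Fin (suc n) by punchIn x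
deleteVertex : {n : ℕ} → Graph (suc n) → Fin (suc n) → Graph n
deleteVertex G x = record
  { Adj    = λ i j → Adj G (punchIn x i) (punchIn x j)
  ; sym    = sym G
  ; irrefl = irrefl G }

restrict : {n c : ℕ} → Coloring (suc n) c → Fin (suc n) → Coloring n c
restrict col x i = col (punchIn x i)

module Submission where

-- Let T be a class of pairwise false twins (equal neighbourhoods) sharing one
-- colour, with x ∈ T.  The key observation is that a move at u recolours all
-- members of T other than u alike: a monochromatic walk from u reaching one of
-- them can be rerouted to any other.  Hence after a move, T - u is again such a
-- class, and a flooding sequence of length m shrinks T by at most one per move.
-- While T has a member y ≠ x, x is redundant: walks through x can be redirected
-- through y (so components of G - x are those of G minus x), and if a sequence
-- plays x itself, conjugating it by the transposition (x y), an automorphism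
-- fixing the colouring, turns it into one that plays y instead.
--
-- From these we prove that, while |T| ≥ m + 2,
-- G floods from col in m moves iff G - x floods from col restricted, and
-- lemma14 follows by comparing lengths with OPT.

open import Defs
open import Data.Nat using (ℕ; zero; suc; _+_; _≤_; _≤?_; s≤s)
open import Data.Nat.Properties using (≤-trans; ≤-pred; n≤1+n; m≤n+m; ≰⇒>; <⇒≤; +-monoˡ-≤)
open import Data.Fin using (Fin; zero; suc; punchIn; punchOut)
open import Data.Fin.Properties using (_≟_; suc-injective; punchIn-injective; punchInᵢ≢i; punchIn-punchOut)
open import Data.Fin.Subset using (Subset; _∈_; _∉_; ∣_∣; _─_; _-_; ⁅_⁆; inside; outside)
open import Data.Fin.Subset.Properties
  using (p─q⊆p; p⊆q⇒∣p∣≤∣q∣; ∣p∣≤∣x∷p∣; drop-there; x∈p∧x≢y⇒x∈p-y; x∉⁅y⁆⇒x≢y; nonempty?; Empty-unique; ∣⊥∣≡0)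
open import Data.Vec using (_∷_)
open import Data.Vec.Base using (here; there)
open import Data.Vec.Functional using (insertAt)
open import Data.Vec.Functional.Properties using (insertAt-lookup; insertAt-punchIn)
open import Data.Product using (Σ; ∃; _×_; _,_; proj₁; proj₂)
open import Function using (_∘_; id)
open import Relation.Nullary using (¬_; Dec; yes; no; contradiction)
open import Relation.Nullary.Decidable using (decidable-stable)
open import Relation.Binary.PropositionalEquality
  using (_≡_; _≢_; refl; trans; cong; subst; subst₂) renaming (sym to ≡-sym)

splitOn : (P : Set) {Q : Set} → Dec Q → (P → Q) → (¬ P → Q) → Q
splitOn P q? onP on¬P = decidable-stable q? λ ¬q → ¬q (on¬P λ p → ¬q (onP p))

NbhdSub : {N : ℕ} → Graph N → Fin N → Fin N → Set
NbhdSub G a b = ∀ v → Adj G a v → Adj G b v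

FalseTwins : {N : ℕ} → Graph N → Subset N → Set
FalseTwins G T = ∀ a b → a ∈ T → b ∈ T → NbhdSub G a b

ConstantOn : {N c : ℕ} → Coloring N c → Subset N → Set
ConstantOn col T = ∀ a b → a ∈ T → b ∈ T → col a ≡ col b

mapWalk : ∀ {N M c} {G : Graph N} {H : Graph M} {colG : Coloring N c} {colH : Coloring M c}
  (f : Fin N → Fin M) → (∀ {a b} → Adj G a b → Adj H (f a) (f b)) → (∀ a → colH (f a) ≡ colG a) →
  ∀ {a b} → MonoPath G colG a b → MonoPath H colH (f a) (f b)
mapWalk f hom pres here = here
mapWalk f hom pres (step e same p) =
  step (hom e) (trans (pres _) (trans same (≡-sym (pres _)))) (mapWalk f hom pres p)

module _ {N c : ℕ} {G : Graph N} where

  -- A monochromatic walk from u ≠ a to a can be redirected to any vertex b of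
  -- colour col a that sees all neighbours of a: replace its last edge.
  rerouteToTwin : ∀ {col : Coloring N c} {a b u} → NbhdSub G a b → col a ≡ col b →
    MonoPath G col u a → u ≢ a → MonoPath G col u b
  rerouteToTwin a⊆b same here u≢a = contradiction refl u≢a
  rerouteToTwin {a = a} a⊆b same (step {w = w} e same′ p) u≢a with w ≟ a
  ... | yes refl = step (sym G (a⊆b _ (sym G e))) (trans same′ same) here
  ... | no w≢a = step e same′ (rerouteToTwin a⊆b same p w≢a)

  twinsRecolouredAlike : ∀ {col col′ : Coloring N c} {u c′ a b} → IsMoveResult G col u c′ col′ →
    NbhdSub G a b → NbhdSub G b a → col a ≡ col b → u ≢ a → u ≢ b → col′ a ≡ col′ b
  twinsRecolouredAlike {col′ = col′} {u} {a = a} {b} mv a⊆b b⊆a same u≢a u≢b =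
    splitOn (MonoPath G _ u a) (col′ a ≟ col′ b)
      (λ p → trans (proj₁ (mv a) p) (≡-sym (proj₁ (mv b) (rerouteToTwin a⊆b same p u≢a))))
      (λ ¬p → trans (proj₂ (mv a) ¬p)
                (trans same (≡-sym (proj₂ (mv b) (¬p ∘ λ q → rerouteToTwin b⊆a (≡-sym same) q u≢b)))))

  moveExt : ∀ {col col₂ col′ : Coloring N c} {u c′} → (∀ v → col v ≡ col₂ v) →
    IsMoveResult G col u c′ col′ → IsMoveResult G col₂ u c′ col′
  moveExt eq mv v =
    (λ p → proj₁ (mv v) (mapWalk id id eq p)) ,
    (λ ¬p → trans (proj₂ (mv v) (¬p ∘ mapWalk id id (≡-sym ∘ eq))) (eq v))

  floodsExt : ∀ m {col col₂ : Coloring N c} → (∀ v → col v ≡ col₂ v) → FloodsIn G col m → FloodsIn G col₂ m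
  floodsExt zero eq const v w = trans (≡-sym (eq v)) (trans (const v w) (eq w))
  floodsExt (suc m) eq (u , c′ , col′ , mv , rest) = u , c′ , col′ , moveExt eq mv , rest

module Automorphism {N c : ℕ} (G : Graph N) (σ : Fin N → Fin N)
  (involutive : ∀ z → σ (σ z) ≡ z) (hom : ∀ {a b} → Adj G a b → Adj G (σ a) (σ b)) where

  moveAut : ∀ {col col′ : Coloring N c} {u c′} →
    IsMoveResult G col u c′ col′ → IsMoveResult G (col ∘ σ) (σ u) c′ (col′ ∘ σ)
  moveAut {col} {u = u} mv v =
    (λ p → proj₁ (mv (σ v)) (subst (λ z → MonoPath G col z (σ v)) (involutive u)
                               (mapWalk σ hom (λ _ → refl) p))) ,
    (λ ¬p → proj₂ (mv (σ v)) (λ p → ¬p (subst (MonoPath G (col ∘ σ) (σ u)) (involutive v)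
                               (mapWalk σ hom (cong col ∘ involutive) p))))

  floodsAut : ∀ m (col : Coloring N c) → FloodsIn G col m → FloodsIn G (col ∘ σ) m
  floodsAut zero col const v w = const (σ v) (σ w)
  floodsAut (suc m) col (u , c′ , col′ , mv , rest) =
    σ u , c′ , col′ ∘ σ , moveAut mv , floodsAut m col′ rest

module Transposition {N : ℕ} (x y : Fin N) where

  swap : Fin N → Fin N
  swap z with z ≟ x | z ≟ y
  ... | yes _ | _     = y
  ... | no _  | yes _ = x
  ... | no _  | no _  = z

  data SwapView (z : Fin N) : Fin N → Set where
    at-x  : z ≡ x → SwapView z y
    at-y  : z ≡ y → SwapView z x
    fixed : z ≢ x → z ≢ y → SwapView z z

  view : ∀ z → SwapView z (swap z)
  view z with z ≟ x | z ≟ y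
  ... | yes z≡x | _       = at-x z≡x
  ... | no _    | yes z≡y = at-y z≡y
  ... | no z≢x  | no z≢y  = fixed z≢x z≢y

  swap-x : swap x ≡ y
  swap-x with swap x | view x
  ... | _ | at-x _       = refl
  ... | _ | at-y x≡y     = x≡y
  ... | _ | fixed x≢x _  = contradiction refl x≢x

  swap-y : swap y ≡ x
  swap-y with swap y | view y
  ... | _ | at-x y≡x     = y≡x
  ... | _ | at-y _       = refl
  ... | _ | fixed _ y≢y  = contradiction refl y≢y

  swap-fixed : ∀ {z} → z ≢ x → z ≢ y → swap z ≡ z
  swap-fixed {z} z≢x z≢y with swap z | view z
  ... | _ | at-x z≡x  = contradiction z≡x z≢x
  ... | _ | at-y z≡y  = contradiction z≡y z≢y
  ... | _ | fixed _ _ = refl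

  involutive : ∀ z → swap (swap z) ≡ z
  involutive z with swap z | view z
  ... | _ | at-x refl       = swap-y
  ... | _ | at-y refl       = swap-x
  ... | _ | fixed z≢x z≢y   = swap-fixed z≢x z≢y

  swap-hom : (G : Graph N) → NbhdSub G x y → NbhdSub G y x →
    ∀ {a b} → Adj G a b → Adj G (swap a) (swap b)
  swap-hom G x⊆y y⊆x {a} {b} e with swap a | view a | swap b | view b
  ... | _ | at-x refl | _ | at-x refl = contradiction e (irrefl G)
  ... | _ | at-x refl | _ | at-y refl = contradiction (x⊆y _ e) (irrefl G)
  ... | _ | at-x refl | _ | fixed _ _ = x⊆y b e
  ... | _ | at-y refl | _ | at-x refl = contradiction (y⊆x _ e) (irrefl G)
  ... | _ | at-y refl | _ | at-y refl = contradiction e (irrefl G)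
  ... | _ | at-y refl | _ | fixed _ _ = y⊆x b e
  ... | _ | fixed _ _ | _ | at-x refl = sym G (x⊆y a (sym G e))
  ... | _ | fixed _ _ | _ | at-y refl = sym G (y⊆x a (sym G e))
  ... | _ | fixed _ _ | _ | fixed _ _ = e

  swap-colour : ∀ {c} {col : Fin N → Fin c} → col x ≡ col y → ∀ z → col (swap z) ≡ col z
  swap-colour same z with swap z | view z
  ... | _ | at-x refl   = ≡-sym same
  ... | _ | at-y refl   = same
  ... | _ | fixed _ _   = refl

x∈p─q⇒x∉q : ∀ {N} (p q : Subset N) {x} → x ∈ p ─ q → x ∉ q
x∈p─q⇒x∉q (_ ∷ p) (outside ∷ q) here ()
x∈p─q⇒x∉q (_ ∷ p) (_ ∷ q) (there x∈p─q) (there x∈q) = x∈p─q⇒x∉q p q x∈p─q x∈q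

∈-remove⁻ : ∀ {N} {p : Subset N} {x z} → x ∈ p - z → x ∈ p × x ≢ z
∈-remove⁻ {p = p} {z = z} x∈p-z = p─q⊆p p ⁅ z ⁆ x∈p-z , x∉⁅y⁆⇒x≢y (x∈p─q⇒x∉q p ⁅ z ⁆ x∈p-z)

∣p∣≤1+∣q∣ : ∀ {N} (p q : Subset N) z → (∀ {t} → t ∈ p → t ≢ z → t ∈ q) → ∣ p ∣ ≤ suc ∣ q ∣
∣p∣≤1+∣q∣ (inside ∷ p) (s ∷ q) zero almost⊆ =
  s≤s (≤-trans (p⊆q⇒∣p∣≤∣q∣ (drop-there ∘ λ t∈p → almost⊆ (there t∈p) λ ())) (∣p∣≤∣x∷p∣ s q))
∣p∣≤1+∣q∣ (outside ∷ p) (s ∷ q) zero almost⊆ =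
  ≤-trans (p⊆q⇒∣p∣≤∣q∣ (drop-there ∘ λ t∈p → almost⊆ (there t∈p) λ ())) (≤-trans (∣p∣≤∣x∷p∣ s q) (n≤1+n _))
∣p∣≤1+∣q∣ (inside ∷ p) (s ∷ q) (suc z) almost⊆ with almost⊆ here (λ ())
... | here = s≤s (∣p∣≤1+∣q∣ p q z λ t∈p t≢z → drop-there (almost⊆ (there t∈p) (t≢z ∘ suc-injective)))
∣p∣≤1+∣q∣ (outside ∷ p) (s ∷ q) (suc z) almost⊆ =
  ≤-trans (∣p∣≤1+∣q∣ p q z λ t∈p t≢z → drop-there (almost⊆ (there t∈p) (t≢z ∘ suc-injective)))
          (s≤s (∣p∣≤∣x∷p∣ s q))

shrink : ∀ {N k} (p : Subset N) z → suc k ≤ ∣ p ∣ → k ≤ ∣ p - z ∣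
shrink p z size = ≤-pred (≤-trans size (∣p∣≤1+∣q∣ p (p - z) z (x∈p∧x≢y⇒x∈p-y {p = p})))

otherElement : ∀ {N} (p : Subset N) z → 2 ≤ ∣ p ∣ → ∃ λ y → y ∈ p × y ≢ z
otherElement {N} p z size with nonempty? (p - z)
... | yes (y , y∈p-z) = y , ∈-remove⁻ y∈p-z
... | no empty = contradiction (subst (1 ≤_) ∣p-z∣≡0 (shrink p z size)) λ ()
  where
  ∣p-z∣≡0 : ∣ p - z ∣ ≡ 0
  ∣p-z∣≡0 = trans (cong ∣_∣ (Empty-unique empty)) (∣⊥∣≡0 N)

classAfterMove : ∀ {N c} {G : Graph N} {col col′ : Coloring N c} {u c′} {T : Subset N} →
  IsMoveResult G col u c′ col′ → FalseTwins G T → ConstantOn col T →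
  FalseTwins G (T - u) × ConstantOn col′ (T - u)
classAfterMove {G = G} {col′ = col′} {u} {T = T} mv twins same = twins′ , same′
  where
  twins′ : FalseTwins G (T - u)
  twins′ a b a∈ b∈ = twins a b (proj₁ (∈-remove⁻ a∈)) (proj₁ (∈-remove⁻ b∈))
  same′ : ConstantOn col′ (T - u)
  same′ a b a∈ b∈ with ∈-remove⁻ a∈ | ∈-remove⁻ b∈
  ... | a∈T , a≢u | b∈T , b≢u =
    twinsRecolouredAlike mv (twins a b a∈T b∈T) (twins b a b∈T a∈T) (same a b a∈T b∈T)
                         (a≢u ∘ ≡-sym) (b≢u ∘ ≡-sym)

data VertexOf {n : ℕ} (x : Fin (suc n)) : Fin (suc n) → Set where
  deleted : VertexOf x x
  kept    : ∀ v → VertexOf x (punchIn x v)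

vertexOf : ∀ {n} (x z : Fin (suc n)) → VertexOf x z
vertexOf x z with x ≟ z
... | yes refl = deleted
... | no x≢z   = subst (VertexOf x) (punchIn-punchOut x≢z) (kept (punchOut x≢z))

module Deletion {n c : ℕ} (G : Graph (suc n)) (x : Fin (suc n)) where

  private
    Gx : Graph n
    Gx = deleteVertex G x

    ι : Fin n → Fin (suc n)
    ι = punchIn x

  embedWalk : ∀ {col : Coloring (suc n) c} {a b} →
    MonoPath Gx (restrict col x) a b → MonoPath G col (ι a) (ι b)
  embedWalk = mapWalk ι id (λ _ → refl)

  record SurvivingTwin (col : Coloring (suc n) c) (y : Fin n) : Set where
    field
      x⊆y  : NbhdSub G x (ι y)
      y⊆x  : NbhdSub G (ι y) x
      same : col x ≡ col (ι y)

  twinInClass : ∀ {col : Coloring (suc n) c} {T y} → FalseTwins G T → ConstantOn col T →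
    x ∈ T → ι y ∈ T → SurvivingTwin col y
  twinInClass twins same x∈T y∈T = record
    { x⊆y = twins _ _ x∈T y∈T ; y⊆x = twins _ _ y∈T x∈T ; same = same _ _ x∈T y∈T }

  survivingMember : (T : Subset (suc n)) → 2 ≤ ∣ T ∣ → ∃ λ y → ι y ∈ T
  survivingMember T size with otherElement T x size
  ... | z , z∈T , z≢x with vertexOf x z
  ...   | deleted = contradiction refl z≢x
  ...   | kept y  = y , z∈T

  -- Given a surviving twin y of x, walks of G between surviving vertices
  -- survive in G - x: replace every visit of x by a visit of y.
  module Redirect {col : Coloring (suc n) c} {y : Fin n} (twin : SurvivingTwin col y) where
    open SurvivingTwin twin

    redirect : Fin (suc n) → Fin n
    redirect z with x ≟ z
    ... | yes _   = y
    ... | no x≢z  = punchOut x≢z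

    redirect-x : redirect x ≡ y
    redirect-x with x ≟ x
    ... | yes _  = refl
    ... | no x≢x = contradiction refl x≢x

    redirect-ι : ∀ v → redirect (ι v) ≡ v
    redirect-ι v with x ≟ ι v
    ... | yes x≡ιv = contradiction (≡-sym x≡ιv) (punchInᵢ≢i x v)
    ... | no x≢ιv  = punchIn-injective x _ _ (punchIn-punchOut x≢ιv)

    redirect-hom : ∀ {a b} → Adj G a b → Adj Gx (redirect a) (redirect b)
    redirect-hom {a} {b} e with vertexOf x a | vertexOf x b
    ... | deleted | deleted = contradiction e (irrefl G)
    ... | deleted | kept b′ rewrite redirect-x | redirect-ι b′ = x⊆y _ e
    ... | kept a′ | deleted rewrite redirect-x | redirect-ι a′ = sym G (x⊆y _ (sym G e))
    ... | kept a′ | kept b′ rewrite redirect-ι a′ | redirect-ι b′ = e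

    redirect-colour : ∀ z → restrict col x (redirect z) ≡ col z
    redirect-colour z with vertexOf x z
    ... | deleted rewrite redirect-x = ≡-sym same
    ... | kept v  rewrite redirect-ι v = refl

    liftWalk : ∀ {a b} → MonoPath G col (ι a) (ι b) → MonoPath Gx (restrict col x) a b
    liftWalk {a} {b} p =
      subst₂ (MonoPath Gx (restrict col x)) (redirect-ι a) (redirect-ι b)
        (mapWalk redirect redirect-hom redirect-colour p)

  restrictMove : ∀ {col col′ : Coloring (suc n) c} {u c′ y} → SurvivingTwin col y →
    IsMoveResult G col (ι u) c′ col′ → IsMoveResult Gx (restrict col x) u c′ (restrict col′ x)
  restrictMove twin mv v =
    (λ p → proj₁ (mv (ι v)) (embedWalk p)) , (λ ¬p → proj₂ (mv (ι v)) (¬p ∘ liftWalk))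
    where open Redirect twin

  -- Conversely, a move of G - x extends to G by giving x the new colour of a
  -- twin y of x that is not the played vertex.
  extendMove : ∀ {col : Coloring (suc n) c} {colx′ : Coloring n c} {u c′} (y : Fin n) →
    SurvivingTwin col y → u ≢ y →
    IsMoveResult Gx (restrict col x) u c′ colx′ →
    IsMoveResult G col (ι u) c′ (insertAt colx′ x (colx′ y))
  extendMove {colx′ = colx′} {u} y twin u≢y mv v with vertexOf x v
  ... | deleted =
    (λ p → trans (insertAt-lookup colx′ x _)
             (proj₁ (mv y) (liftWalk (rerouteToTwin x⊆y same p (punchInᵢ≢i x u))))) ,
    (λ ¬p → trans (insertAt-lookup colx′ x _)
              (trans (proj₂ (mv y) (¬p ∘ λ q → rerouteToTwin y⊆x (≡-sym same) (embedWalk q) ιu≢ιy))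
                     (≡-sym same)))
    where
    open Redirect twin
    open SurvivingTwin twin
    ιu≢ιy : ι u ≢ ι y
    ιu≢ιy = u≢y ∘ punchIn-injective x u y
  ... | kept v′ =
    (λ p → trans (insertAt-punchIn colx′ x _ v′) (proj₁ (mv v′) (liftWalk p))) ,
    (λ ¬p → trans (insertAt-punchIn colx′ x _ v′) (proj₂ (mv v′) (¬p ∘ embedWalk)))
    where open Redirect twin

  constantExtends : ∀ {col : Coloring (suc n) c} {y} → SurvivingTwin col y →
    Constant (restrict col x) → Constant col
  constantExtends {col} {y} twin const v w = trans (toY v) (≡-sym (toY w))
    where
    toY : ∀ z → col z ≡ col (ι y)
    toY z with vertexOf x z
    ... | deleted = SurvivingTwin.same twin
    ... | kept z′ = const z′ y

  -- A flooding sequence whose first move is at x can be replaced by one of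
  -- the same length whose first move is at the twin y of x: conjugate it by
  -- the transposition of x and y, which fixes col.
  firstMoveAvoiding : ∀ {m} {col : Coloring (suc n) c} {y} → SurvivingTwin col y → FloodsIn G col (suc m) →
    Σ (Fin n) λ u → Σ (Fin c) λ c′ → Σ (Coloring (suc n) c) λ col′ →
      IsMoveResult G col (ι u) c′ col′ × FloodsIn G col′ m
  firstMoveAvoiding {m} {col} {y} twin (u , c′ , col′ , mv , rest) with vertexOf x u
  ... | kept u′ = u′ , c′ , col′ , mv , rest
  ... | deleted =
    y , c′ , col′ ∘ swap ,
    subst (λ z → IsMoveResult G col z c′ (col′ ∘ swap)) swap-x (moveExt (swap-colour same) (moveAut mv)) ,
    floodsAut m col′ rest
    where
    open SurvivingTwin twin
    open Transposition x (ι y)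
    open Automorphism G swap involutive (swap-hom G x⊆y y⊆x)

  -- Let T ∋ x be a monochromatic class of false twins with |T| ≥ m + 2.  Then
  -- flooding G in m moves gives flooding G - x in m moves: first move off x,
  -- restrict it, and continue with the class T minus the played vertex.
  floodsAfterDeletion : ∀ m (col : Coloring (suc n) c) (T : Subset (suc n)) →
    FalseTwins G T → ConstantOn col T → x ∈ T → m + 2 ≤ ∣ T ∣ →
    FloodsIn G col m → FloodsIn Gx (restrict col x) m
  floodsAfterDeletion zero col T _ _ _ _ const v w = const (ι v) (ι w)
  floodsAfterDeletion (suc m) col T twins same x∈T size flood
    with survivingMember T (≤-trans (m≤n+m 2 (suc m)) size)
  ... | y , y∈T with firstMoveAvoiding (twinInClass twins same x∈T y∈T) flood
  ...   | u , c′ , col′ , mv , rest =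
    u , c′ , restrict col′ x , restrictMove (twinInClass twins same x∈T y∈T) mv ,
    floodsAfterDeletion m col′ (T - ι u) (proj₁ class) (proj₂ class)
      (x∈p∧x≢y⇒x∈p-y x∈T (punchInᵢ≢i x u ∘ ≡-sym)) (shrink T (ι u) size) rest
    where
    class : FalseTwins G (T - ι u) × ConstantOn col′ (T - ι u)
    class = classAfterMove mv twins same

  -- Under the same hypotheses, flooding G - x in m moves gives flooding G in
  -- m moves: each move is extended to x through a member of T other than x
  -- and the played vertex.
  floodsBeforeDeletion : ∀ m (col : Coloring (suc n) c) (T : Subset (suc n)) →
    FalseTwins G T → ConstantOn col T → x ∈ T → m + 2 ≤ ∣ T ∣ →
    FloodsIn Gx (restrict col x) m → FloodsIn G col m
  floodsBeforeDeletion zero col T twins same x∈T size const with survivingMember T size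
  ... | y , y∈T = constantExtends (twinInClass twins same x∈T y∈T) const
  floodsBeforeDeletion (suc m) col T twins same x∈T size (u , c′ , colx′ , mv , rest)
    with survivingMember (T - ι u) (≤-trans (m≤n+m 2 m) (shrink T (ι u) size))
  ... | y , y∈T-ιu with ∈-remove⁻ y∈T-ιu
  ...   | y∈T , ιy≢ιu =
    ι u , c′ , col′ , move ,
    floodsBeforeDeletion m col′ (T - ι u) (proj₁ class) (proj₂ class)
      (x∈p∧x≢y⇒x∈p-y x∈T (punchInᵢ≢i x u ∘ ≡-sym)) (shrink T (ι u) size)
      (floodsExt m (≡-sym ∘ insertAt-punchIn colx′ x (colx′ y)) rest)
    where
    col′ : Coloring (suc n) c
    col′ = insertAt colx′ x (colx′ y)
    move : IsMoveResult G col (ι u) c′ col′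
    move = extendMove y (twinInClass twins same x∈T y∈T) (ιy≢ιu ∘ cong ι ∘ ≡-sym) mv
    class : FalseTwins G (T - ι u) × ConstantOn col′ (T - ι u)
    class = classAfterMove move twins same

lemma14 : ∀ {n c : ℕ} (G : Graph (suc n)) (col : Coloring (suc n) c) (S : Subset (suc n)) →
    (∀ a b → a ∈ S → b ∈ S → ∀ v → (Adj G a v → Adj G b v) × (Adj G b v → Adj G a v)) →
    (∀ a b → a ∈ S → b ∈ S → col a ≡ col b) →
    ∀ (k : ℕ) → IsOPTFree G col k → k + 2 ≤ ∣ S ∣ →
    ∀ x → x ∈ S → IsOPTFree (deleteVertex G x) (restrict col x) k
lemma14 {n} {c} G col S neighbours same k (floods , optimal) size x x∈S =
  floodsAfterDeletion k col S twins same x∈S size floods , optimalAfterDeletion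
  where
  open Deletion {n} {c} G x

  twins : FalseTwins G S
  twins a b a∈S b∈S v = proj₁ (neighbours a b a∈S b∈S v)

  -- A shorter flooding sequence of G - x would lift to one of G.
  optimalAfterDeletion : ∀ m → FloodsIn (deleteVertex G x) (restrict col x) m → k ≤ m
  optimalAfterDeletion m floods-x with k ≤? m
  ... | yes k≤m = k≤m
  ... | no k≰m = optimal m (floodsBeforeDeletion m col S twins same x∈S m+2≤∣S∣ floods-x)
    where
    m+2≤∣S∣ : m + 2 ≤ ∣ S ∣
    m+2≤∣S∣ = ≤-trans (+-monoˡ-≤ 2 (<⇒≤ (≰⇒> k≰m))) size
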